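{- Let $[w,n]$ be a basis element of $\mathbf{W}$ and let $\alpha,\beta\vDash\ell(w)$ be the compositions with $I(\alpha)=\mathrm{Peak}(w)$ and $I(\beta)=\mathrm{Val}(w)$. Then $$\Psi_{>|\le}([w,n])=K_\alpha,\quad\Psi_{<|\ge}([w,n])=K_\beta,\quad\Psi_{\ge|<}([w^{\mathtt r},n])=K_{\alpha^\flat},\quad\Psi_{\le|>}([w^{\mathtt r},n])=K_{\beta^\flat}.$$
   Context: Fix a field $\mathbb{k}$ (of characteristic not $2$ where $K_\alpha$ bases are used; the identities are equalities in $\mathsf{QSym}$). A word is a finite sequence of positive integers; $\ell(w)$ is its length, $w^{\mathtt r}$ its reversal; $\mathrm{Peak}(w)=\{i:1<i<\ell(w),\ w_{i-1}\le w_i>w_{i+1}\}$ and $\mathrm{Val}(w)=\{i:1<i<\ell(w),\ w_{i-1}\ge w_i<w_{i+1}\}$. $\mathbf{W}$ is the $\mathbb{k}$-vector space with basis symbols $[w,n]$ ($n\in\mathbb{N}$, $w$ a word with letters $\le n$). For $\alpha=(\alpha_1,\dots,\alpha_r)\vDash N$, $I(\alpha)=\{\alpha_1,\alpha_1+\alpha_2,\dots,\alpha_1+\cdots+\alpha_{r-1}\}$. A peak composition is one with $\alpha_i\ge2$ for $1\le i<r$; for such $\alpha$, $\alpha^\flat=(\alpha_r+1,\alpha_{r-1},\dots,\alpha_2,\alpha_1-1)$ and $K_\alpha=\sum_{\gamma\vDash N,\ I(\alpha)\subseteq I(\gamma)\cup(I(\gamma)+1)}2^{\ell(\gamma)}M_\gamma$,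 where $\ell(\gamma)$ is the number of parts and $M_\gamma=\sum_{i_1<\cdots<i_s}x_{i_1}^{\gamma_1}\cdots x_{i_s}^{\gamma_s}$ ($M_\emptyset=1$). For $\bullet\in\{\le,\ge,<,>\}$, $\zeta_\bullet:\mathbf{W}\to\mathbb{k}$ is the linear map with $\zeta_\bullet([w,n])=1$ if $w$ is respectively weakly increasing, weakly decreasing, strictly increasing, strictly decreasing (including $w=\emptyset$), and $0$ otherwise. For $\bullet,\circ$ in this set, $\zeta_{\bullet|\circ}([w_1\cdots w_k,n])=\sum_{i=0}^k\zeta_\bullet([w_1\cdots w_i,n])\,\zeta_\circ([w_{i+1}\cdots w_k,n])$. For a linear $\zeta:\mathbf{W}\to\mathbb{k}$ and composition $\gamma=(\gamma_1,\dots,\gamma_s)$, $\zeta_\gamma([w,n])=\prod_{i=1}^s\zeta([w^{(i)},n])$ if $\gamma\vDash\ell(w)$ and $w=w^{(1)}\cdots w^{(s)}$ with $\ell(w^{(i)})=\gamma_i$, and $0$ otherwise; $\zeta_\emptyset([w,n])=1$ if $w=\emptyset$, else $0$. Then $\Psi_{\bullet|\circ}:\mathbf{W}\to\mathsf{QSym}$ is the linear map $\Psi_{\bullet|\circ}(x)=\sum_\gamma(\zeta_{\bullet|\circ})_\gamma(x)M_\gamma$. -}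

module Defs where

open import Level using (Level)
open import Data.Bool using (Bool; true; false; if_then_else_; _∧_)
open import Data.Nat using (ℕ; zero; suc; _≤_; _<_; _>_; _≥_; _≤?_; _<?_; _≥?_; _>?_; _≟_)
  renaming (_+_ to _+ℕ_; _∸_ to _∸ℕ_)
open import Data.List using (List; []; _∷_; length; take; drop; reverse; map; foldr; upTo)
open import Data.Nat.ListAction using (sum)
open import Data.List.Relation.Unary.All using (All)
open import Data.List.Relation.Unary.Any using (Any; any?)
open import Data.List.Relation.Unary.All using (all?)
open import Data.List.Relation.Unary.Linked using (Linked; linked?)
open import Data.List.Membership.Propositional using (_∈_)
open import Data.List.Membership.DecPropositional _≟_ using (_∈?_)
open import Data.Product using (_×_; ∃)
open import Data.Sum using (_⊎_)
open import Relation.Nullary using (¬_; Dec; does; _⊎-dec_)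
open import Relation.Binary.Core using (Rel)
open import Relation.Binary.Definitions using (Decidable)
open import Relation.Binary.PropositionalEquality using (_≡_)
open import Function.Bundles using (_⇔_)
open import Algebra.Bundles using (CommutativeRing)

record IsFieldCharNot2 {c ℓ : Level} (R : CommutativeRing c ℓ) : Set (c Level.⊔ ℓ) where
  open CommutativeRing R
  field
    nontrivial  : ¬ (1# ≈ 0#)
    inverse     : ∀ x → ¬ (x ≈ 0#) → ∃ λ y → x * y ≈ 1#
    charNot2    : ¬ (1# + 1# ≈ 0#)

Word : Set
Word = List ℕ

-- A basis element [w,n] of 𝐖 : every letter of w lies in {1,…,n}.
IsBasisWord : ℕ → Word → Set
IsBasisWord n w = All (λ a → 1 ≤ a × a ≤ n) w

Composition : Set
Composition = List ℕ

IsComposition : Composition → Set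
IsComposition γ = All (λ p → 1 ≤ p) γ

_⊨_ : Composition → ℕ → Set
γ ⊨ N = IsComposition γ × sum γ ≡ N

partialSumsFrom : ℕ → Composition → List ℕ
partialSumsFrom s []           = []
partialSumsFrom s (a ∷ [])     = []
partialSumsFrom s (a ∷ b ∷ γ)  = (s +ℕ a) ∷ partialSumsFrom (s +ℕ a) (b ∷ γ)

I : Composition → List ℕ
I = partialSumsFrom 0

-- 1-indexed letter lookup (value 0 outside 1..ℓ(w); only used in range)
at : Word → ℕ → ℕ
at []      _             = 0
at (a ∷ w) zero          = 0
at (a ∷ w) (suc zero)    = a
at (a ∷ w) (suc (suc i)) = at w (suc i)

Peak : Word → ℕ → Set
Peak w i = 1 < i × i < length w
         × at w (i ∸ℕ 1) ≤ at w i × at w i > at w (suc i)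

Val : Word → ℕ → Set
Val w i = 1 < i × i < length w
        × at w (i ∸ℕ 1) ≥ at w i × at w i < at w (suc i)

-- α^♭ = (α_r+1, α_{r-1}, …, α_2, α_1-1)  (r ≥ 2);
-- for r = 1 we take α^♭ = α and for r = 0, α^♭ = ∅.
decLast : List ℕ → List ℕ
decLast []          = []
decLast (x ∷ [])    = (x ∸ℕ 1) ∷ []
decLast (x ∷ y ∷ l) = x ∷ decLast (y ∷ l)

flatRev : List ℕ → Composition
flatRev []           = []
flatRev (a ∷ [])     = a ∷ []
flatRev (a ∷ b ∷ l)  = suc a ∷ decLast (b ∷ l)

_♭ : Composition → Composition
α ♭ = flatRev (reverse α)

module Over {c ℓ : Level} (R : CommutativeRing c ℓ) where
  open CommutativeRing R

  -- QSym (in the monomial basis): an element is given by its coefficient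
  -- of M_γ for every composition γ.
  QSym : Set c
  QSym = Composition → Carrier

  _≈Q_ : QSym → QSym → Set ℓ
  f ≈Q g = ∀ γ → IsComposition γ → f γ ≈ g γ

  -- Linear functionals on 𝐖, given on basis elements [w,n]
  -- (the value never depends on n for the maps used here).
  Zeta : Set c
  Zeta = Word → Carrier

  ζ[_] : {_∙_ : Rel ℕ Level.zero} → Decidable _∙_ → Zeta
  ζ[ d ] w = if does (linked? d w) then 1# else 0#

  ζ≤ ζ≥ ζ< ζ> : Zeta
  ζ≤ = ζ[ _≤?_ ]
  ζ≥ = ζ[ _≥?_ ]
  ζ< = ζ[ _<?_ ]
  ζ> = ζ[ _>?_ ]

  sumR : List Carrier → Carrier
  sumR = foldr _+_ 0#

  _∣_ : Zeta → Zeta → Zeta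
  (ζ₁ ∣ ζ₂) w = sumR (map (λ i → ζ₁ (take i w) * ζ₂ (drop i w)) (upTo (suc (length w))))

  zetaComp : Zeta → Composition → Word → Carrier
  zetaComp ζ []      []      = 1#
  zetaComp ζ []      (_ ∷ _) = 0#
  zetaComp ζ (g ∷ γ) w       =
    if does (g ≤? length w) then ζ (take g w) * zetaComp ζ γ (drop g w) else 0#

  Ψ : Zeta → Word → QSym
  Ψ ζ w γ = zetaComp ζ γ w

  two^ : ℕ → Carrier
  two^ zero    = 1#
  two^ (suc k) = (1# + 1#) * two^ k

  -- I(α) ⊆ I(γ) ∪ (I(γ)+1), decided
  -- (i ∈ I(γ)+1  is  "i = j+1 for some j ∈ I(γ)")
  coverDec : (α γ : Composition) → Dec (All (λ i → i ∈ I γ ⊎ Any (λ j → i ≡ suc j) (I γ)) (I α))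
  coverDec α γ = all? (λ i → (i ∈? I γ) ⊎-dec any? (λ j → i ≟ suc j) (I γ)) (I α)

  K : Composition → QSym
  K α γ = if does (sum γ ≟ sum α) ∧ does (coverDec α γ) then two^ (length γ) else 0#

-- For complementary relations R₁ and R₂ (R₂ a b exactly when ¬ R₁ a b), a nonempty word u has
-- exactly two factorisations as an R₁-chain followed by an R₂-chain if it has no R₂–R₁ pattern
-- (a position j with R₂ u_{j-1} u_j and R₁ u_j u_{j+1}), and none otherwise; so the convolution
-- ζ_{R₁|R₂}(u) is 2 or 0.  Cutting u into the blocks prescribed by γ destroys exactly the
-- patterns sitting at the end or the start of a block, i.e. at positions in I(γ) ∪ (I(γ) + 1).
-- Hence the coefficient of M_γ in Ψ_{R₁|R₂}(u) is 2^ℓ(γ) when I(γ) ∪ (I(γ) + 1) contains all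
-- patterns of u and 0 otherwise, which is the coefficient of K_α when the patterns of u form
-- I(α).  Peaks are the ≤–> patterns and valleys the ≥–< patterns; on wʳ the <–≥ and >–≤
-- patterns sit at the mirror images j ↦ ℓ(w) + 1 − j of the peaks and valleys of w, and
-- I(α♭) is the mirror image of I(α).

module Submission where

open import Defs
open import Level using (Level; 0ℓ)
open import Algebra.Bundles using (CommutativeRing)
open import Data.Bool using (if_then_else_; _∧_)
open import Data.Empty using (⊥-elim)
open import Data.Nat using (ℕ; zero; suc; pred; _+_; _∸_; _≤_; _<_; z≤n; s≤s; _≟_; _≤?_; _<?_; _≥?_; _>?_)
open import Data.Nat.Properties
  using (+-assoc; +-comm; +-commutativeSemigroup; +-identityʳ; +-suc; +-cancelˡ-≡; +-cancelˡ-≤; +-monoˡ-≤;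
         suc-injective; ≤-refl; ≤-trans; ≤-pred; <⇒≤; <⇒≱; ≤⇒≯; ≮⇒≥; ≰⇒>; n≤1+n; m≤m+n; m≤n+m; m∸n≤m; m+[n∸m]≡n)
open import Data.Nat.ListAction using (sum)
open import Data.Nat.ListAction.Properties using (sum-↭)
open import Data.Product using (_×_; _,_; proj₁; proj₂; ∃-syntax)
open import Data.Sum using (_⊎_; inj₁; inj₂; [_,_]′)
open import Data.List using (List; []; _∷_; [_]; _++_; _∷ʳ_; length; reverse; map; take; drop; upTo)
open import Data.List.Properties
  using (length-++; length-drop; length-reverse; unfold-reverse; reverse-involutive; ++-identityʳ; map-cong; map-applyUpTo)
open import Data.List.Relation.Unary.All using (All; _∷_; lookup)
open import Data.List.Relation.Unary.All.Properties.Core using (¬All⇒Any¬)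
open import Data.List.Relation.Unary.Any using (Any; here; there; any?)
import Data.List.Relation.Unary.Any as Any
import Data.List.Relation.Unary.Any.Properties as Any
open import Data.List.Relation.Unary.Linked using (Linked; []; [-]; _∷_; linked?)
open import Data.List.Relation.Binary.Permutation.Propositional using (↭-sym)
open import Data.List.Relation.Binary.Permutation.Propositional.Properties using (↭-reverse; All-resp-↭)
open import Data.List.Membership.Propositional using (_∈_; find)
open import Data.List.Membership.Propositional.Properties using (∈-map⁺; ∈-map⁻; ∈-++⁺ˡ; ∈-++⁺ʳ; ∈-++⁻)
open import Data.List.Membership.DecPropositional _≟_ using (_∈?_)
open import Relation.Nullary using (¬_; Dec; yes; no; does; _⊎-dec_)
open import Relation.Nullary.Decidable using (dec-true; dec-false; decidable-stable)
import Relation.Unary as U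
open import Relation.Binary.Core using (Rel)
open import Relation.Binary.Definitions using (Decidable)
open import Relation.Binary.PropositionalEquality using (_≡_; _≢_; refl; sym; trans; cong; cong₂; subst; subst₂; module ≡-Reasoning)
open import Function using (_∘_; id; flip)
open import Function.Bundles using (Equivalence; _⇔_; mk⇔)
import Function.Properties.Equivalence as ⇔
open import Algebra.Properties.CommutativeSemigroup +-commutativeSemigroup using (x∙yz≈y∙xz)

-- Positions are 1-based as in `at`; Peak = Pattern _≤_ _>_ and Val = Pattern _≥_ _<_ definitionally.
Pattern : Rel ℕ 0ℓ → Rel ℕ 0ℓ → Word → ℕ → Set
Pattern S T w j = 1 < j × j < length w × S (at w (j ∸ 1)) (at w j) × T (at w j) (at w (suc j))

at-++ˡ : ∀ xs ys j → j ≤ length xs → at (xs ++ ys) j ≡ at xs j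
at-++ˡ []       []       zero          _        = refl
at-++ˡ []       (_ ∷ _)  zero          _        = refl
at-++ˡ (_ ∷ _)  _        zero          _        = refl
at-++ˡ (_ ∷ _)  _        (suc zero)    _        = refl
at-++ˡ (_ ∷ xs) ys       (suc (suc j)) (s≤s j≤) = at-++ˡ xs ys (suc j) j≤

at-++-∷ : ∀ xs y ys → at (xs ++ y ∷ ys) (suc (length xs)) ≡ y
at-++-∷ []       y ys = refl
at-++-∷ (_ ∷ xs) y ys = at-++-∷ xs y ys

at-reverse : ∀ w j i → j + i ≡ length w → at (reverse w) j ≡ at w (suc i)
at-reverse []      j i       _ = refl
at-reverse (a ∷ w) j zero    e rewrite unfold-reverse a w = begin
  at (reverse w ++ [ a ]) j                          ≡⟨ cong (at (reverse w ++ [ a ])) j≡ ⟩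
  at (reverse w ++ [ a ]) (suc (length (reverse w))) ≡⟨ at-++-∷ (reverse w) a [] ⟩
  a                                                  ∎
  where
  open ≡-Reasoning
  j≡ : j ≡ suc (length (reverse w))
  j≡ = trans (sym (+-identityʳ j)) (trans e (cong suc (sym (length-reverse w))))
at-reverse (a ∷ w) j (suc i) e rewrite unfold-reverse a w = begin
  at (reverse w ++ [ a ]) j ≡⟨ at-++ˡ (reverse w) [ a ] j j≤ ⟩
  at (reverse w) j          ≡⟨ at-reverse w j i e′ ⟩
  at w (suc i)              ∎
  where
  open ≡-Reasoning
  e′ : j + i ≡ length w
  e′ = suc-injective (trans (sym (+-suc j i)) e)
  j≤ : j ≤ length (reverse w)
  j≤ = subst (j ≤_) (trans e′ (sym (length-reverse w))) (m≤m+n j i)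

take-length-++ : ∀ (p q : Word) → take (length p) (p ++ q) ≡ p
take-length-++ []      q = refl
take-length-++ (x ∷ p) q = cong (x ∷_) (take-length-++ p q)

drop-length-++ : ∀ (p q : Word) → drop (length p) (p ++ q) ≡ q
drop-length-++ []      q = refl
drop-length-++ (x ∷ p) q = drop-length-++ p q

splitAt-length : ∀ g (u : Word) → g ≤ length u → ∃[ p ] ∃[ q ] length p ≡ g × p ++ q ≡ u
splitAt-length zero    u       _ = [] , u , refl , refl
splitAt-length (suc g) (x ∷ u) (s≤s g≤u)
  with p , q , refl , refl ← splitAt-length g u g≤u = x ∷ p , q , refl , refl

splitAt-sum : ∀ g γ (u : Word) → g + sum γ ≡ length u →
              ∃[ p ] ∃[ q ] length p ≡ g × p ++ q ≡ u × sum γ ≡ length q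
splitAt-sum g γ u e with p , q , refl , refl ← splitAt-length g u (subst (g ≤_) e (m≤m+n g (sum γ))) =
  p , q , refl , refl , +-cancelˡ-≡ (length p) _ _ (trans e (length-++ p))

partialSumsFrom-+ : ∀ s t γ → partialSumsFrom (s + t) γ ≡ map (s +_) (partialSumsFrom t γ)
partialSumsFrom-+ s t []          = refl
partialSumsFrom-+ s t (a ∷ [])    = refl
partialSumsFrom-+ s t (a ∷ b ∷ γ) = cong₂ _∷_ (+-assoc s t a)
  (trans (cong (λ x → partialSumsFrom x (b ∷ γ)) (+-assoc s t a)) (partialSumsFrom-+ s (t + a) (b ∷ γ)))

I-∷ : ∀ g h γ → I (g ∷ h ∷ γ) ≡ g ∷ map (g +_) (I (h ∷ γ))
I-∷ g h γ = cong (g ∷_)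
  (trans (cong (λ x → partialSumsFrom x (h ∷ γ)) (sym (+-identityʳ g))) (partialSumsFrom-+ g 0 (h ∷ γ)))

∈-I-∷⁻ : ∀ g h γ {i} → i ∈ I (g ∷ h ∷ γ) → i ≡ g ⊎ ∃[ i′ ] i′ ∈ I (h ∷ γ) × i ≡ g + i′
∈-I-∷⁻ g h γ {i} i∈ with subst (i ∈_) (I-∷ g h γ) i∈
... | here i≡g  = inj₁ i≡g
... | there i∈′ = inj₂ (∈-map⁻ (g +_) i∈′)

partialSumsFrom-∷ʳ : ∀ s x γ a →
                     partialSumsFrom s ((x ∷ γ) ∷ʳ a) ≡ partialSumsFrom s (x ∷ γ) ++ [ s + sum (x ∷ γ) ]
partialSumsFrom-∷ʳ s x []      a = cong (λ y → [ s + y ]) (sym (+-identityʳ x))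
partialSumsFrom-∷ʳ s x (y ∷ γ) a = cong ((s + x) ∷_) (trans (partialSumsFrom-∷ʳ (s + x) y γ a)
  (cong (λ z → partialSumsFrom (s + x) (y ∷ γ) ++ [ z ]) (+-assoc s x _)))

I-∷ʳ : ∀ γ a → 0 < length γ → I (γ ∷ʳ a) ≡ I γ ++ [ sum γ ]
I-∷ʳ (x ∷ γ) a _ = partialSumsFrom-∷ʳ 0 x γ a

sum-reverse : ∀ γ → sum (reverse γ) ≡ sum γ
sum-reverse γ = sum-↭ (↭-reverse γ)

I-reverse-∷ : ∀ a b γ → I (reverse (a ∷ b ∷ γ)) ≡ I (reverse (b ∷ γ)) ++ [ sum (b ∷ γ) ]
I-reverse-∷ a b γ = begin
  I (reverse (a ∷ b ∷ γ))                          ≡⟨ cong I (unfold-reverse a (b ∷ γ)) ⟩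
  I (reverse (b ∷ γ) ∷ʳ a)                         ≡⟨ I-∷ʳ (reverse (b ∷ γ)) a 0<length ⟩
  I (reverse (b ∷ γ)) ++ [ sum (reverse (b ∷ γ)) ] ≡⟨ cong (λ z → I (reverse (b ∷ γ)) ++ [ z ]) (sum-reverse (b ∷ γ)) ⟩
  I (reverse (b ∷ γ)) ++ [ sum (b ∷ γ) ]           ∎
  where
  open ≡-Reasoning
  0<length : 0 < length (reverse (b ∷ γ))
  0<length = subst (0 <_) (sym (length-reverse (b ∷ γ))) (s≤s z≤n)

∈-I-reverse⁺ : ∀ α j → j ∈ I (reverse α) → ∃[ i ] i ∈ I α × j + i ≡ sum α
∈-I-reverse⁺ (a ∷ b ∷ γ) j j∈ =
  [ shift ∘ ∈-I-reverse⁺ (b ∷ γ) j , last ]′ (∈-++⁻ (I (reverse (b ∷ γ))) (subst (j ∈_) (I-reverse-∷ a b γ) j∈))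
  where
  shift : ∃[ i ] i ∈ I (b ∷ γ) × j + i ≡ sum (b ∷ γ) → ∃[ i ] i ∈ I (a ∷ b ∷ γ) × j + i ≡ sum (a ∷ b ∷ γ)
  shift (i , i∈ , e) =
    a + i , subst (a + i ∈_) (sym (I-∷ a b γ)) (there (∈-map⁺ (a +_) i∈)) , trans (x∙yz≈y∙xz j a i) (cong (a +_) e)
  last : j ∈ [ sum (b ∷ γ) ] → ∃[ i ] i ∈ I (a ∷ b ∷ γ) × j + i ≡ sum (a ∷ b ∷ γ)
  last (here refl) = a , subst (a ∈_) (sym (I-∷ a b γ)) (here refl) , +-comm (sum (b ∷ γ)) a

∈-I-reverse⁻ : ∀ α i j → i ∈ I α → j + i ≡ sum α → j ∈ I (reverse α)
∈-I-reverse⁻ (a ∷ b ∷ γ) i j i∈ e = subst (j ∈_) (sym (I-reverse-∷ a b γ)) (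
  [ (λ i≡a → ∈-++⁺ʳ (I (reverse (b ∷ γ)))
       (here (+-cancelˡ-≡ a j _ (trans (+-comm a j) (trans (cong (j +_) (sym i≡a)) e)))))
  , (λ (i′ , i′∈ , i≡) → ∈-++⁺ˡ (∈-I-reverse⁻ (b ∷ γ) i′ j i′∈
       (+-cancelˡ-≡ a _ _ (trans (x∙yz≈y∙xz a j i′) (trans (cong (j +_) (sym i≡)) e)))))
  ]′ (∈-I-∷⁻ a b γ i∈))

partialSumsFrom-decLast : ∀ s γ → partialSumsFrom s (decLast γ) ≡ partialSumsFrom s γ
partialSumsFrom-decLast s []              = refl
partialSumsFrom-decLast s (x ∷ [])        = refl
partialSumsFrom-decLast s (x ∷ y ∷ [])    = refl
partialSumsFrom-decLast s (x ∷ y ∷ z ∷ γ) = cong ((s + x) ∷_) (partialSumsFrom-decLast (s + x) (y ∷ z ∷ γ))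

I-flatRev : ∀ γ → I (flatRev γ) ≡ map suc (I γ)
I-flatRev []          = refl
I-flatRev (a ∷ [])    = refl
I-flatRev (a ∷ b ∷ γ) = begin
  I (decLast (suc a ∷ b ∷ γ))             ≡⟨ partialSumsFrom-decLast 0 (suc a ∷ b ∷ γ) ⟩
  suc a ∷ partialSumsFrom (1 + a) (b ∷ γ) ≡⟨ cong (suc a ∷_) (partialSumsFrom-+ 1 a (b ∷ γ)) ⟩
  map suc (I (a ∷ b ∷ γ))                 ∎
  where open ≡-Reasoning

I-♭ : ∀ α → I (α ♭) ≡ map suc (I (reverse α))
I-♭ α = I-flatRev (reverse α)

sum-decLast : ∀ x γ → IsComposition (x ∷ γ) → suc (sum (decLast (x ∷ γ))) ≡ sum (x ∷ γ)
sum-decLast (suc x) []      _          = refl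
sum-decLast x       (y ∷ γ) (_ ∷ yγ⊨) = trans (sym (+-suc x _)) (cong (x +_) (sum-decLast y γ yγ⊨))

sum-flatRev : ∀ γ → IsComposition γ → sum (flatRev γ) ≡ sum γ
sum-flatRev []          _          = refl
sum-flatRev (a ∷ [])    _          = refl
sum-flatRev (a ∷ b ∷ γ) (_ ∷ bγ⊨) = trans (sym (+-suc a _)) (cong (a +_) (sum-decLast b γ bγ⊨))

sum-♭ : ∀ α → IsComposition α → sum (α ♭) ≡ sum α
sum-♭ α α⊨ = trans (sum-flatRev (reverse α) (All-resp-↭ (↭-sym (↭-reverse α)) α⊨)) (sum-reverse α)

∈-I-♭⁺ : ∀ α j → j ∈ I (α ♭) → ∃[ i ] i ∈ I α × j + i ≡ suc (sum α)
∈-I-♭⁺ α j j∈ with ∈-map⁻ suc (subst (j ∈_) (I-♭ α) j∈)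
... | j′ , j′∈ , refl with ∈-I-reverse⁺ α j′ j′∈
... | i , i∈ , e = i , i∈ , cong suc e

∈-I-♭⁻ : ∀ α i j → i ∈ I α → j + i ≡ sum α → suc j ∈ I (α ♭)
∈-I-♭⁻ α i j i∈ e = subst (suc j ∈_) (sym (I-♭ α)) (∈-map⁺ suc (∈-I-reverse⁻ α i j i∈ e))

-- j ∈ L ∪ (L + 1), in the form decided by coverDec.
Covers : List ℕ → ℕ → Set
Covers L j = j ∈ L ⊎ Any (λ k → j ≡ suc k) L

covers? : ∀ L → U.Decidable (Covers L)
covers? L j = (j ∈? L) ⊎-dec any? (λ k → j ≟ suc k) L

covers-shift : ∀ g L k → Covers L k → Covers (g ∷ map (g +_) L) (g + k)
covers-shift g L k (inj₁ k∈) = inj₁ (there (∈-map⁺ (g +_) k∈))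
covers-shift g L k (inj₂ k≡) =
  inj₂ (there (Any.map⁺ (Any.map (λ {x} k≡1+x → trans (cong (g +_) k≡1+x) (+-suc g x)) k≡)))

covers-unshift : ∀ g L k → Covers (g ∷ map (g +_) L) (g + suc (suc k)) → Covers L (suc (suc k))
covers-unshift g L k (inj₁ (here e))
  with () ← +-cancelˡ-≡ g (suc (suc k)) 0 (trans e (sym (+-identityʳ g)))
covers-unshift g L k (inj₁ (there k∈)) with x , x∈ , e ← ∈-map⁻ (g +_) k∈ =
  inj₁ (subst (_∈ L) (sym (+-cancelˡ-≡ g _ _ e)) x∈)
covers-unshift g L k (inj₂ (here e))
  with () ← +-cancelˡ-≡ g (suc (suc k)) 1 (trans e (sym (+-comm g 1)))
covers-unshift g L k (inj₂ (there k≡)) =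
  inj₂ (Any.map (λ {x} e → +-cancelˡ-≡ g _ _ (trans e (sym (+-suc g x)))) (Any.map⁻ k≡))

covers-≥ : ∀ g L j → Covers (g ∷ map (g +_) L) j → g ≤ j
covers-≥ g L j (inj₁ (here refl)) = ≤-refl
covers-≥ g L j (inj₁ (there j∈)) with x , _ , refl ← ∈-map⁻ (g +_) j∈ = m≤m+n g x
covers-≥ g L j (inj₂ (here refl)) = n≤1+n g
covers-≥ g L j (inj₂ (there j≡)) with x , refl ← Any.satisfied (Any.map⁻ j≡) =
  ≤-trans (m≤m+n g x) (n≤1+n (g + x))

covers-I-∷ : ∀ g γ j → Covers (I (g ∷ γ)) j → Covers (g ∷ map (g +_) (I γ)) j
covers-I-∷ g []      j (inj₁ ())
covers-I-∷ g []      j (inj₂ ())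
covers-I-∷ g (h ∷ γ) j = subst (λ L → Covers L j) (I-∷ g h γ)

covers-I-∷-shift : ∀ g γ k → Covers (I γ) k → Covers (I (g ∷ γ)) (g + k)
covers-I-∷-shift g []      k (inj₁ ())
covers-I-∷-shift g []      k (inj₂ ())
covers-I-∷-shift g (h ∷ γ) k c = subst (λ L → Covers L (g + k)) (sym (I-∷ g h γ)) (covers-shift g (I (h ∷ γ)) k c)

covers-I-∷-boundary : ∀ g h γ {j} → j ≡ g ⊎ j ≡ suc g → Covers (I (g ∷ h ∷ γ)) j
covers-I-∷-boundary g h γ {j} j≡ = subst (λ L → Covers L j) (sym (I-∷ g h γ)) (boundary j≡)
  where
  boundary : j ≡ g ⊎ j ≡ suc g → Covers (g ∷ map (g +_) (I (h ∷ γ))) j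
  boundary (inj₁ refl) = inj₁ (here refl)
  boundary (inj₂ refl) = inj₂ (here refl)

≥-cases : ∀ g j → g ≤ j → j ≡ g ⊎ j ≡ suc g ⊎ ∃[ k ] j ≡ g + suc (suc k)
≥-cases zero    zero          _ = inj₁ refl
≥-cases zero    (suc zero)    _ = inj₂ (inj₁ refl)
≥-cases zero    (suc (suc k)) _ = inj₂ (inj₂ (k , refl))
≥-cases (suc g) (suc j) (s≤s g≤j) with ≥-cases g j g≤j
... | inj₁ refl              = inj₁ refl
... | inj₂ (inj₁ refl)       = inj₂ (inj₁ refl)
... | inj₂ (inj₂ (k , refl)) = inj₂ (inj₂ (k , refl))

module Patterns (S T : Rel ℕ 0ℓ) where

  P : Word → ℕ → Set
  P = Pattern S T

  pattern-∷ : ∀ a w j → 2 ≤ j → P (a ∷ w) (suc j) ⇔ P w j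
  pattern-∷ a w (suc (suc j)) (s≤s (s≤s z≤n)) =
    mk⇔ (λ { (_ , s≤s j< , s , t) → s≤s (s≤s z≤n) , j< , s , t })
        (λ (_ , j< , s , t) → s≤s (s≤s z≤n) , s≤s j< , s , t)

  pattern-++ˡ : ∀ p q j → j < length p → P (p ++ q) j ⇔ P p j
  pattern-++ˡ p q j j<p =
    mk⇔ (λ (1<j , _ , s , t) → 1<j , j<p , subst₂ S e₋ e₀ s , subst₂ T e₀ e₊ t)
        (λ (1<j , _ , s , t) → 1<j , j<pq , subst₂ S (sym e₋) (sym e₀) s , subst₂ T (sym e₀) (sym e₊) t)
    where
    j<pq : j < length (p ++ q)
    j<pq = subst (j <_) (sym (length-++ p)) (≤-trans j<p (m≤m+n (length p) (length q)))
    e₋ : at (p ++ q) (j ∸ 1) ≡ at p (j ∸ 1)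
    e₋ = at-++ˡ p q (j ∸ 1) (≤-trans (m∸n≤m j 1) (<⇒≤ j<p))
    e₀ : at (p ++ q) j ≡ at p j
    e₀ = at-++ˡ p q j (<⇒≤ j<p)
    e₊ : at (p ++ q) (suc j) ≡ at p (suc j)
    e₊ = at-++ˡ p q (suc j) j<p

  pattern-++ʳ : ∀ p q j → 2 ≤ j → P (p ++ q) (length p + j) ⇔ P q j
  pattern-++ʳ []      q j 2≤j = ⇔.refl
  pattern-++ʳ (a ∷ p) q j 2≤j =
    ⇔.trans (pattern-∷ a (p ++ q) (length p + j) (≤-trans 2≤j (m≤n+m j (length p)))) (pattern-++ʳ p q j 2≤j)

  covered-++ : ∀ p q γ → (∀ j → P (p ++ q) j → Covers (I (length p ∷ γ)) j) →
               (∀ j → ¬ P p j) × (∀ j → P q j → Covers (I γ) j)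
  covered-++ p q γ covered = none-in-p , covered-in-q
    where
    none-in-p : ∀ j → ¬ P p j
    none-in-p j pj = <⇒≱ j<p (covers-≥ (length p) (I γ) j
      (covers-I-∷ (length p) γ j (covered j (Equivalence.from (pattern-++ˡ p q j j<p) pj))))
      where
      j<p : j < length p
      j<p = proj₁ (proj₂ pj)
    covered-in-q : ∀ j → P q j → Covers (I γ) j
    covered-in-q zero            (() , _)
    covered-in-q (suc zero)      (s≤s () , _)
    covered-in-q j@(suc (suc k)) qj = covers-unshift (length p) (I γ) k
      (covers-I-∷ (length p) γ _ (covered _ (Equivalence.from (pattern-++ʳ p q j (proj₁ qj)) qj)))

  boundary-covered : ∀ p q γ {j} → sum γ ≡ length q → P (p ++ q) j → j ≡ length p ⊎ j ≡ suc (length p) →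
                     Covers (I (length p ∷ γ)) j
  boundary-covered p q  (h ∷ γ)     _ _            j≡ = covers-I-∷-boundary (length p) h γ j≡
  boundary-covered p [] []      {j} _ (_ , j< , _) j≡ =
    ⊥-elim (<⇒≱ (subst (j <_) (cong length (++-identityʳ p)) j<) (p≤j j≡))
    where
    p≤j : j ≡ length p ⊎ j ≡ suc (length p) → length p ≤ j
    p≤j (inj₁ refl) = ≤-refl
    p≤j (inj₂ refl) = n≤1+n (length p)

  uncovered-++ : ∀ p q γ {j} → sum γ ≡ length q → P (p ++ q) j → ¬ Covers (I (length p ∷ γ)) j →
                 (∃[ j′ ] P p j′) ⊎ (∃[ k ] P q k × ¬ Covers (I γ) k)
  uncovered-++ p q γ {j} sγ pqj uncovered with j <? length p
  ... | yes j<p = inj₁ (j , Equivalence.to (pattern-++ˡ p q j j<p) pqj)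
  ... | no j≮p with ≥-cases (length p) j (≮⇒≥ j≮p)
  ...   | inj₁ j≡        = ⊥-elim (uncovered (boundary-covered p q γ sγ pqj (inj₁ j≡)))
  ...   | inj₂ (inj₁ j≡) = ⊥-elim (uncovered (boundary-covered p q γ sγ pqj (inj₂ j≡)))
  ...   | inj₂ (inj₂ (k , refl)) =
    inj₂ (suc (suc k) , Equivalence.to (pattern-++ʳ p q (suc (suc k)) (s≤s (s≤s z≤n))) pqj ,
          λ c → uncovered (covers-I-∷-shift (length p) γ _ c))

  linked⇒no-pattern : (∀ {a b} → T a b → ¬ S a b) → ∀ {u} → Linked S u → ∀ j → ¬ P u j
  linked⇒no-pattern T⇒¬S (_ ∷ s ∷ _) (suc (suc zero)) (_ , _ , _ , t) = T⇒¬S t s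
  linked⇒no-pattern T⇒¬S {a ∷ w} (_ ∷ l) (suc j@(suc (suc _))) p =
    linked⇒no-pattern T⇒¬S l j (Equivalence.to (pattern-∷ a w j (s≤s (s≤s z≤n))) p)
  linked⇒no-pattern T⇒¬S []         j                (_ , () , _)
  linked⇒no-pattern T⇒¬S [-]        (suc (suc _))    (_ , s≤s () , _)
  linked⇒no-pattern T⇒¬S (_ ∷ [-])  (suc (suc zero)) (_ , s≤s (s≤s ()) , _)
  linked⇒no-pattern T⇒¬S l          zero             (() , _)
  linked⇒no-pattern T⇒¬S l          (suc zero)       (s≤s () , _)

  unlinked⇒pattern : Decidable T → (∀ {a b} → ¬ T a b → S a b) →
                     ∀ {a b} v → S a b → ¬ Linked S (b ∷ v) → ∃[ j ] P (a ∷ b ∷ v) j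
  unlinked⇒pattern T? ¬T⇒S []      s ¬l = ⊥-elim (¬l [-])
  unlinked⇒pattern T? ¬T⇒S {a} {b} (c ∷ v) s ¬l with T? b c
  ... | yes t = 2 , s≤s (s≤s z≤n) , s≤s (s≤s (s≤s z≤n)) , s , t
  ... | no ¬t with j , p ← unlinked⇒pattern T? ¬T⇒S v (¬T⇒S ¬t) (¬l ∘ (¬T⇒S ¬t ∷_)) =
    suc j , Equivalence.from (pattern-∷ a (b ∷ c ∷ v) j (proj₁ p)) p

  pattern-∷-T : (∀ {a b} → T a b → ¬ S a b) → ∀ {a b} v j → T a b → P (a ∷ b ∷ v) j → P (b ∷ v) (pred j)
  pattern-∷-T T⇒¬S v (suc (suc zero)) t (_ , _ , s , _) = ⊥-elim (T⇒¬S t s)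
  pattern-∷-T T⇒¬S {a} {b} v (suc j@(suc (suc _))) t p =
    Equivalence.to (pattern-∷ a (b ∷ v) j (s≤s (s≤s z≤n))) p
  pattern-∷-T T⇒¬S v zero       t (() , _)
  pattern-∷-T T⇒¬S v (suc zero) t (s≤s () , _)

reflected-bounds : ∀ {n} j i → j + i ≡ suc n → 1 < j → j < n → 1 < i × i < n
reflected-bounds j i e 1<j j<n =
  +-cancelˡ-≤ j 2 i (subst₂ _≤_ (+-comm 2 j) (sym e) (s≤s j<n)) ,
  ≤-pred (subst (suc (suc i) ≤_) e (+-monoˡ-≤ i 1<j))

pattern-reverse : ∀ {S T} w j i → j + i ≡ suc (length w) →
                  Pattern S T (reverse w) j → Pattern (flip T) (flip S) w i
pattern-reverse w zero       i e (() , _)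
pattern-reverse w (suc zero) i e (s≤s () , _)
pattern-reverse w j@(suc (suc _)) zero e (1<j , j< , _)
  with () , _ ← reflected-bounds j zero e 1<j (subst (j <_) (length-reverse w) j<)
pattern-reverse w j@(suc (suc _)) (suc zero) e (1<j , j< , _)
  with s≤s () , _ ← reflected-bounds j 1 e 1<j (subst (j <_) (length-reverse w) j<)
pattern-reverse {S} {T} w (suc (suc j)) (suc (suc i)) e (1<j , j< , s , t) =
  s≤s (s≤s z≤n) , i< ,
  subst₂ T (at-reverse w _ _ e₀) (at-reverse w _ _ e₊) t ,
  subst₂ S (at-reverse w _ _ e₋) (at-reverse w _ _ e₀) s
  where
  i< : suc (suc i) < length w
  i< = proj₂ (reflected-bounds (suc (suc j)) (suc (suc i)) e 1<j (subst (suc (suc j) <_) (length-reverse w) j<))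
  e₀ : suc (suc j) + suc i ≡ length w
  e₀ = suc-injective (trans (sym (+-suc (suc (suc j)) (suc i))) e)
  e₊ : suc (suc (suc j)) + i ≡ length w
  e₊ = trans (sym (+-suc (suc (suc j)) i)) e₀
  e₋ : suc j + suc (suc i) ≡ length w
  e₋ = trans (+-suc (suc j) (suc i)) e₀

pattern-reverse⇔ : ∀ {S T} w j i → j + i ≡ suc (length w) →
                   Pattern S T (reverse w) j ⇔ Pattern (flip T) (flip S) w i
pattern-reverse⇔ {S} {T} w j i e = mk⇔ (pattern-reverse {S} {T} w j i e) from
  where
  e′ : i + j ≡ suc (length (reverse w))
  e′ = trans (+-comm i j) (trans e (cong suc (sym (length-reverse w))))
  from : Pattern (flip T) (flip S) w i → Pattern S T (reverse w) j
  from p = pattern-reverse {flip T} {flip S} (reverse w) i j e′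
    (subst (λ v → Pattern (flip T) (flip S) v i) (sym (reverse-involutive w)) p)

patterns-♭ : ∀ {S T} w α → sum α ≡ length w → (∀ i → i ∈ I α ⇔ Pattern (flip T) (flip S) w i) →
             ∀ j → j ∈ I (α ♭) ⇔ Pattern S T (reverse w) j
patterns-♭ {S} {T} w α sα patterns j = mk⇔ to from
  where
  to : j ∈ I (α ♭) → Pattern S T (reverse w) j
  to j∈ with i , i∈ , e ← ∈-I-♭⁺ α j j∈ =
    Equivalence.from (pattern-reverse⇔ {S} {T} w j i (trans e (cong suc sα))) (Equivalence.to (patterns i) i∈)
  from : Pattern S T (reverse w) j → j ∈ I (α ♭)
  from p@(s≤s (s≤s z≤n) , j< , _) = ∈-I-♭⁻ α i (pred j) i∈ (suc-injective (trans e (cong suc (sym sα))))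
    where
    i : ℕ
    i = suc (length w) ∸ j
    e : j + i ≡ suc (length w)
    e = m+[n∸m]≡n (≤-trans (<⇒≤ (subst (j <_) (length-reverse w) j<)) (n≤1+n (length w)))
    i∈ : i ∈ I α
    i∈ = Equivalence.from (patterns i) (Equivalence.to (pattern-reverse⇔ {S} {T} w j i e) p)

module _ {c ℓ : Level} (R : CommutativeRing c ℓ) where

  open Over R
  open CommutativeRing R using (Carrier; _≈_; 0#; 1#; setoid; zeroˡ; zeroʳ)
    renaming ( _+_ to _+ᴿ_; _*_ to _*ᴿ_; refl to ≈-refl; trans to ≈-trans; reflexive to ≈-reflexive
             ; +-cong to +ᴿ-cong; +-congˡ to +ᴿ-congˡ; +-congʳ to +ᴿ-congʳ
             ; *-cong to *ᴿ-cong; *-congˡ to *ᴿ-congˡ; *-congʳ to *ᴿ-congʳ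
             ; +-identityˡ to +ᴿ-identityˡ; +-identityʳ to +ᴿ-identityʳ; *-identityˡ to *ᴿ-identityˡ )
  open import Relation.Binary.Reasoning.Setoid setoid

  ζ-linked : ∀ {S : Rel ℕ 0ℓ} (S? : Decidable S) {u} → Linked S u → ζ[ S? ] u ≡ 1#
  ζ-linked S? {u} l = cong (if_then 1# else 0#) (dec-true (linked? S? u) l)

  ζ-unlinked : ∀ {S : Rel ℕ 0ℓ} (S? : Decidable S) {u} → ¬ Linked S u → ζ[ S? ] u ≡ 0#
  ζ-unlinked S? {u} ¬l = cong (if_then 1# else 0#) (dec-false (linked? S? u) ¬l)

  ζ-∷-related : ∀ {S : Rel ℕ 0ℓ} (S? : Decidable S) {a b} v → S a b →
                ζ[ S? ] (a ∷ b ∷ v) ≡ ζ[ S? ] (b ∷ v)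
  ζ-∷-related S? {a} {b} v s with S? a b
  ... | yes _ = refl
  ... | no ¬s = ⊥-elim (¬s s)

  ζ-∷-unrelated : ∀ {S : Rel ℕ 0ℓ} (S? : Decidable S) {a b} v → ¬ S a b → ζ[ S? ] (a ∷ b ∷ v) ≡ 0#
  ζ-∷-unrelated S? {a} {b} v ¬s with S? a b
  ... | yes s = ⊥-elim (¬s s)
  ... | no _  = refl

  ∣-∷ : ∀ ζ₁ ζ₂ a u → (ζ₁ ∣ ζ₂) (a ∷ u) ≡ ζ₁ [] *ᴿ ζ₂ (a ∷ u) +ᴿ ((ζ₁ ∘ (a ∷_)) ∣ ζ₂) u
  ∣-∷ ζ₁ ζ₂ a u = cong (ζ₁ [] *ᴿ ζ₂ (a ∷ u) +ᴿ_)
    (cong sumR (trans (map-applyUpTo suc t n) (sym (map-applyUpTo id (t ∘ suc) n))))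
    where
    n : ℕ
    n = suc (length u)
    t : ℕ → Carrier
    t i = ζ₁ (take i (a ∷ u)) *ᴿ ζ₂ (drop i (a ∷ u))

  ∣-congˡ : ∀ {ζ₁ ζ₁′} ζ₂ → (∀ x → ζ₁ x ≡ ζ₁′ x) → ∀ u → (ζ₁ ∣ ζ₂) u ≡ (ζ₁′ ∣ ζ₂) u
  ∣-congˡ ζ₂ ζ₁≗ζ₁′ u =
    cong sumR (map-cong (λ i → cong (_*ᴿ ζ₂ (drop i u)) (ζ₁≗ζ₁′ _)) (upTo (suc (length u))))

  sumR-zero : ∀ (f : ℕ → Carrier) is → (∀ i → f i ≈ 0#) → sumR (map f is) ≈ 0#
  sumR-zero f []       _   = ≈-refl
  sumR-zero f (i ∷ is) f≈0 = begin
    f i +ᴿ sumR (map f is) ≈⟨ +ᴿ-cong (f≈0 i) (sumR-zero f is f≈0) ⟩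
    0# +ᴿ 0#               ≈⟨ +ᴿ-identityˡ 0# ⟩
    0#                     ∎

  ∣-zeroˡ : ∀ {ζ₁} ζ₂ → (∀ x → ζ₁ x ≡ 0#) → ∀ u → (ζ₁ ∣ ζ₂) u ≈ 0#
  ∣-zeroˡ ζ₂ ζ₁≗0 u = sumR-zero _ (upTo (suc (length u))) (λ i → begin
    _ *ᴿ ζ₂ (drop i u)  ≡⟨ cong (_*ᴿ ζ₂ (drop i u)) (ζ₁≗0 _) ⟩
    0# *ᴿ ζ₂ (drop i u) ≈⟨ zeroˡ _ ⟩
    0#                  ∎)

  two : Carrier
  two = 1# +ᴿ 1#

  zetaComp-++ : ∀ ζ p q γ → zetaComp ζ (length p ∷ γ) (p ++ q) ≡ ζ p *ᴿ zetaComp ζ γ q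
  zetaComp-++ ζ p q γ
    rewrite dec-true (length p ≤? length (p ++ q)) (subst (length p ≤_) (sym (length-++ p)) (m≤m+n _ _))
          | take-length-++ p q
          | drop-length-++ p q
          = refl

  zetaComp-length : ∀ ζ γ u → sum γ ≢ length u → zetaComp ζ γ u ≈ 0#
  zetaComp-length ζ []      []      sγ≢ = ⊥-elim (sγ≢ refl)
  zetaComp-length ζ []      (_ ∷ _) _   = ≈-refl
  zetaComp-length ζ (g ∷ γ) u       sγ≢ = by-fit (g ≤? length u)
    where
    by-fit : (g≤? : Dec (g ≤ length u)) →
             (if does g≤? then ζ (take g u) *ᴿ zetaComp ζ γ (drop g u) else 0#) ≈ 0#
    by-fit (no _)    = ≈-refl
    by-fit (yes g≤u) = begin
      ζ (take g u) *ᴿ zetaComp ζ γ (drop g u) ≈⟨ *ᴿ-congˡ (zetaComp-length ζ γ (drop g u) sγ≢′) ⟩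
      ζ (take g u) *ᴿ 0#                      ≈⟨ zeroʳ _ ⟩
      0#                                      ∎
      where
      sγ≢′ : sum γ ≢ length (drop g u)
      sγ≢′ sγ≡ = sγ≢ (trans (cong (g +_) (trans sγ≡ (length-drop g u))) (m+[n∸m]≡n g≤u))

  module Complementary {R₁ R₂ : Rel ℕ 0ℓ} (R₁? : Decidable R₁) (R₂? : Decidable R₂)
    (R₁⇒¬R₂ : ∀ {a b} → R₁ a b → ¬ R₂ a b) (¬R₁⇒R₂ : ∀ {a b} → ¬ R₁ a b → R₂ a b) where

    ζ₁ ζ₂ F : Zeta
    ζ₁ = ζ[ R₁? ]
    ζ₂ = ζ[ R₂? ]
    F  = ζ₁ ∣ ζ₂

    open Patterns R₂ R₁

    F-[-] : ∀ a → F [ a ] ≈ two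
    F-[-] a = +ᴿ-cong (*ᴿ-identityˡ 1#) (≈-trans (+ᴿ-identityʳ _) (*ᴿ-identityˡ 1#))

    F-∷-R₁ : ∀ {a b} v → R₁ a b → F (a ∷ b ∷ v) ≈ F (b ∷ v)
    F-∷-R₁ {a} {b} v r = begin
      F (a ∷ b ∷ v)
        ≡⟨ ∣-∷ ζ₁ ζ₂ a (b ∷ v) ⟩
      1# *ᴿ ζ₂ (a ∷ b ∷ v) +ᴿ ((ζ₁ ∘ (a ∷_)) ∣ ζ₂) (b ∷ v)
        ≈⟨ +ᴿ-congʳ (≈-trans (*ᴿ-congˡ (≈-reflexive (ζ-∷-unrelated R₂? v (R₁⇒¬R₂ r)))) (zeroʳ 1#)) ⟩
      0# +ᴿ ((ζ₁ ∘ (a ∷_)) ∣ ζ₂) (b ∷ v)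
        ≈⟨ +ᴿ-identityˡ _ ⟩
      ((ζ₁ ∘ (a ∷_)) ∣ ζ₂) (b ∷ v)
        ≡⟨ ∣-∷ (ζ₁ ∘ (a ∷_)) ζ₂ b v ⟩
      1# *ᴿ ζ₂ (b ∷ v) +ᴿ ((ζ₁ ∘ (a ∷_) ∘ (b ∷_)) ∣ ζ₂) v
        ≡⟨ cong (1# *ᴿ ζ₂ (b ∷ v) +ᴿ_) (∣-congˡ ζ₂ (λ x → ζ-∷-related R₁? x r) v) ⟩
      1# *ᴿ ζ₂ (b ∷ v) +ᴿ ((ζ₁ ∘ (b ∷_)) ∣ ζ₂) v
        ≡⟨ ∣-∷ ζ₁ ζ₂ b v ⟨
      F (b ∷ v)
        ∎

    F-∷-¬R₁ : ∀ {a b} v → ¬ R₁ a b → F (a ∷ b ∷ v) ≈ ζ₂ (b ∷ v) +ᴿ ζ₂ (b ∷ v)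
    F-∷-¬R₁ {a} {b} v ¬r = begin
      F (a ∷ b ∷ v)
        ≡⟨ ∣-∷ ζ₁ ζ₂ a (b ∷ v) ⟩
      1# *ᴿ ζ₂ (a ∷ b ∷ v) +ᴿ ((ζ₁ ∘ (a ∷_)) ∣ ζ₂) (b ∷ v)
        ≡⟨ cong₂ _+ᴿ_ (cong (1# *ᴿ_) (ζ-∷-related R₂? v (¬R₁⇒R₂ ¬r))) (∣-∷ (ζ₁ ∘ (a ∷_)) ζ₂ b v) ⟩
      1# *ᴿ ζ₂ (b ∷ v) +ᴿ (1# *ᴿ ζ₂ (b ∷ v) +ᴿ ((ζ₁ ∘ (a ∷_) ∘ (b ∷_)) ∣ ζ₂) v)
        ≈⟨ +ᴿ-cong (*ᴿ-identityˡ _) (+ᴿ-cong (*ᴿ-identityˡ _) (∣-zeroˡ ζ₂ (λ x → ζ-∷-unrelated R₁? x ¬r) v)) ⟩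
      ζ₂ (b ∷ v) +ᴿ (ζ₂ (b ∷ v) +ᴿ 0#)
        ≈⟨ +ᴿ-congˡ (+ᴿ-identityʳ _) ⟩
      ζ₂ (b ∷ v) +ᴿ ζ₂ (b ∷ v)
        ∎

    F-pattern-free : ∀ a v → (∀ j → ¬ P (a ∷ v) j) → F (a ∷ v) ≈ two
    F-pattern-free a []      _    = F-[-] a
    F-pattern-free a (b ∷ v) free = by-first-step (R₁? a b)
      where
      by-first-step : Dec (R₁ a b) → F (a ∷ b ∷ v) ≈ two
      by-first-step (yes r) = begin
        F (a ∷ b ∷ v) ≈⟨ F-∷-R₁ v r ⟩
        F (b ∷ v)     ≈⟨ F-pattern-free b v (λ j p → free (suc j) (Equivalence.from (pattern-∷ a (b ∷ v) j (proj₁ p)) p)) ⟩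
        two           ∎
      by-first-step (no ¬r) = begin
        F (a ∷ b ∷ v)            ≈⟨ F-∷-¬R₁ v ¬r ⟩
        ζ₂ (b ∷ v) +ᴿ ζ₂ (b ∷ v) ≡⟨ cong₂ _+ᴿ_ (ζ-linked R₂? linked) (ζ-linked R₂? linked) ⟩
        two                      ∎
        where
        linked : Linked R₂ (b ∷ v)
        linked = decidable-stable (linked? R₂? (b ∷ v))
          (λ ¬l → let j , p = unlinked⇒pattern R₁? ¬R₁⇒R₂ v (¬R₁⇒R₂ ¬r) ¬l in free j p)

    F-pattern : ∀ a v j → P (a ∷ v) j → F (a ∷ v) ≈ 0#
    F-pattern a []      j (s≤s (s≤s _) , s≤s () , _)
    F-pattern a (b ∷ v) j p = by-first-step (R₁? a b)
      where
      by-first-step : Dec (R₁ a b) → F (a ∷ b ∷ v) ≈ 0#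
      by-first-step (yes r) = begin
        F (a ∷ b ∷ v) ≈⟨ F-∷-R₁ v r ⟩
        F (b ∷ v)     ≈⟨ F-pattern b v (pred j) (pattern-∷-T R₁⇒¬R₂ v j r p) ⟩
        0#            ∎
      by-first-step (no ¬r) = begin
        F (a ∷ b ∷ v)            ≈⟨ F-∷-¬R₁ v ¬r ⟩
        ζ₂ (b ∷ v) +ᴿ ζ₂ (b ∷ v) ≡⟨ cong₂ _+ᴿ_ ζ₂≡0 ζ₂≡0 ⟩
        0# +ᴿ 0#                 ≈⟨ +ᴿ-identityˡ 0# ⟩
        0#                       ∎
        where
        ζ₂≡0 : ζ₂ (b ∷ v) ≡ 0#
        ζ₂≡0 = ζ-unlinked R₂? (λ l → linked⇒no-pattern R₁⇒¬R₂ (¬R₁⇒R₂ ¬r ∷ l) j p)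

    zetaComp-covered : ∀ γ u → IsComposition γ → sum γ ≡ length u →
                       (∀ j → P u j → Covers (I γ) j) → zetaComp F γ u ≈ two^ (length γ)
    zetaComp-covered []      [] _          _  _       = ≈-refl
    zetaComp-covered (g ∷ γ) u  (1≤g ∷ γ⊨) sγ covered
      -- 1 ≤ g rules out an empty first block.
      with x ∷ p , q , refl , refl , sγ′ ← splitAt-sum g γ u sγ
      with free , covered′ ← covered-++ (x ∷ p) q γ covered = begin
        zetaComp F (length (x ∷ p) ∷ γ) (x ∷ p ++ q) ≡⟨ zetaComp-++ F (x ∷ p) q γ ⟩
        F (x ∷ p) *ᴿ zetaComp F γ q                  ≈⟨ *ᴿ-cong (F-pattern-free x p free) IH ⟩
        two *ᴿ two^ (length γ)                       ∎
      where
      IH : zetaComp F γ q ≈ two^ (length γ)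
      IH = zetaComp-covered γ q γ⊨ sγ′ covered′

    zetaComp-uncovered : ∀ γ u {j} → IsComposition γ → sum γ ≡ length u →
                         P u j → ¬ Covers (I γ) j → zetaComp F γ u ≈ 0#
    zetaComp-uncovered []      [] _          _  (_ , () , _) _
    zetaComp-uncovered (g ∷ γ) u  (1≤g ∷ γ⊨) sγ u-pattern uncovered
      with x ∷ p , q , refl , refl , sγ′ ← splitAt-sum g γ u sγ
      with uncovered-++ (x ∷ p) q γ sγ′ u-pattern uncovered
    ... | inj₁ (j , p-pattern) = begin
        zetaComp F (length (x ∷ p) ∷ γ) (x ∷ p ++ q) ≡⟨ zetaComp-++ F (x ∷ p) q γ ⟩
        F (x ∷ p) *ᴿ zetaComp F γ q                  ≈⟨ *ᴿ-congʳ (F-pattern x p j p-pattern) ⟩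
        0# *ᴿ zetaComp F γ q                         ≈⟨ zeroˡ _ ⟩
        0#                                           ∎
    ... | inj₂ (k , q-pattern , q-uncovered) = begin
        zetaComp F (length (x ∷ p) ∷ γ) (x ∷ p ++ q) ≡⟨ zetaComp-++ F (x ∷ p) q γ ⟩
        F (x ∷ p) *ᴿ zetaComp F γ q                  ≈⟨ *ᴿ-congˡ IH ⟩
        F (x ∷ p) *ᴿ 0#                              ≈⟨ zeroʳ _ ⟩
        0#                                           ∎
      where
      IH : zetaComp F γ q ≈ 0#
      IH = zetaComp-uncovered γ q γ⊨ sγ′ q-pattern q-uncovered

    Ψ≈K : ∀ u α → sum α ≡ length u → (∀ j → j ∈ I α ⇔ P u j) → Ψ F u ≈Q K α
    Ψ≈K u α sα patterns γ γ⊨ = coefficient (sum γ ≟ sum α) (coverDec α γ)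
      where
      coefficient : (sγ≟sα : Dec (sum γ ≡ sum α)) (I-covered? : Dec (All (Covers (I γ)) (I α))) →
                    zetaComp F γ u ≈ (if does sγ≟sα ∧ does I-covered? then two^ (length γ) else 0#)
      coefficient (no sγ≢sα) _ = zetaComp-length F γ u (λ sγ≡ → sγ≢sα (trans sγ≡ (sym sα)))
      coefficient (yes sγ≡sα) (yes I-covered) =
        zetaComp-covered γ u γ⊨ (trans sγ≡sα sα) (λ j p → lookup I-covered (Equivalence.from (patterns j) p))
      coefficient (yes sγ≡sα) (no ¬I-covered)
        with j , j∈ , uncovered ← find (¬All⇒Any¬ (covers? (I γ)) (I α) ¬I-covered) =
        zetaComp-uncovered γ u γ⊨ (trans sγ≡sα sα) (Equivalence.to (patterns j) j∈) uncovered

    Ψ-reverse≈K-♭ : ∀ w α → IsComposition α → sum α ≡ length w →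
                    (∀ i → i ∈ I α ⇔ Pattern (flip R₁) (flip R₂) w i) → Ψ F (reverse w) ≈Q K (α ♭)
    Ψ-reverse≈K-♭ w α α⊨ sα patterns =
      Ψ≈K (reverse w) (α ♭) (trans (sum-♭ α α⊨) (trans sα (sym (length-reverse w))))
          (patterns-♭ {R₂} {R₁} w α sα patterns)

proposition5p7 : ∀ {c ℓ : Level} (R : CommutativeRing c ℓ) → IsFieldCharNot2 R →
    (n : ℕ) (w : Word) → IsBasisWord n w →
    (α β : Composition) →
    α ⊨ length w → (∀ i → (i ∈ I α) ⇔ Peak w i) →
    β ⊨ length w → (∀ i → (i ∈ I β) ⇔ Val w i) →
    let open Over R in
      (Ψ (ζ> ∣ ζ≤) w ≈Q K α)
      × (Ψ (ζ< ∣ ζ≥) w ≈Q K β)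
      × (Ψ (ζ≥ ∣ ζ<) (reverse w) ≈Q K (α ♭))
      × (Ψ (ζ≤ ∣ ζ>) (reverse w) ≈Q K (β ♭))
proposition5p7 R _ _ w _ α β (α⊨ , sα) peaks (β⊨ , sβ) valleys =
  ζ>∣ζ≤.Ψ≈K w α sα peaks ,
  ζ<∣ζ≥.Ψ≈K w β sβ valleys ,
  ζ≥∣ζ<.Ψ-reverse≈K-♭ w α α⊨ sα peaks ,
  ζ≤∣ζ>.Ψ-reverse≈K-♭ w β β⊨ sβ valleys
  where
  module ζ>∣ζ≤ = Complementary R _>?_ _≤?_ <⇒≱ ≮⇒≥
  module ζ<∣ζ≥ = Complementary R _<?_ _≥?_ <⇒≱ ≮⇒≥
  module ζ≥∣ζ< = Complementary R _≥?_ _<?_ ≤⇒≯ ≰⇒>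
  module ζ≤∣ζ> = Complementary R _≤?_ _>?_ ≤⇒≯ ≰⇒>
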